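{- Let $n\geq2$, let $\preceq$ be an $n$-ordering system on a set $X$, and let $x_0\in X$. Then for every $t\in[\mathrm{dom}(\preceq_{\{x_0\}})]^{<n}$ we have $\mathrm{predom}(\preceq^{x_0}_t)=\mathrm{predom}(\preceq_{t\cup\{x_0\}})$, where predomains on the left are computed with respect to the $(n-1)$-ordering system $\preceq^{x_0}$ on $\mathrm{dom}(\preceq_{\{x_0\}})$.
   Context: For $0<m<\omega$, an $m$-ordering system on a set $X$ assigns to each $s\in[X]^{<m}$ a relation $\preceq_s\subseteq X^2$, defined recursively: a $1$-ordering system is one with $\preceq_\emptyset$ a non-strict well-order of $X$; for $m>1$, $\preceq$ is an $m$-ordering system if $\preceq_\emptyset$ is a non-strict well-order of $X$ and for every $x_0\in X$ the function $\preceq^{x_0}$ on $[X_{\prec_\emptyset x_0}]^{<m-1}$ given by $\preceq^{x_0}_t=\preceq_{t\cup\{x_0\}}$ is an $(m-1)$-ordering system on $X_{\prec_\emptyset x_0}=\{x:x\prec_\emptyset x_0\}$ (this set equals $\mathrm{dom}(\preceq_{\{x_0\}})$). Here $\prec_s$ is $\preceq_s$ minus the diagonal and $\mathrm{dom}(\preceq_s)=\{x:(x,x)\in\preceq_s\}$. For an $m$-ordering system and $s\in[X]^k$ with $0<k\leq m$, $\mathrm{Min}_\preceq s$ is the unique $y\in s$ with $y\in\mathrm{dom}(\preceq_{s\setminus\{y\}})$ (it exists and is unique). For nonempty $s\in[X]^{\leq m}$, with $y=\mathrm{Min}_\preceq s$ and $s'=s\setminus\{y\}$, $\mathrm{predom}(\preceq_s)=\{x\in\mathrm{dom}(\preceq_{s'}):x\prec_{s'}y\}$;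 and $\mathrm{predom}(\preceq_\emptyset)=X$. -}

module Defs where

open import Level using (Lift)
open import Data.Nat using (ℕ; zero; suc)
open import Data.Empty using (⊥)
open import Data.Unit using (⊤)
open import Data.Product using (Σ; _×_; ∃-syntax)
open import Data.Sum using (_⊎_)
open import Data.List using (List; []; _∷_)
open import Data.List.Membership.Propositional using (_∈_; _∉_)
open import Data.List.Relation.Unary.Unique.Propositional using (Unique)
open import Relation.Binary.PropositionalEquality using (_≡_; _≢_)
open import Relation.Nullary using (¬_)
open import Function.Bundles using (_⇔_)

Pred : Set → Set₁
Pred X = X → Set

Rel : Set → Set₁
Rel X = X → X → Set

-- A "system" assigns to each finite set s (represented by a duplicate-free
-- list; see `Respects`) a relation ≼_s ⊆ X².
System : Set → Set₁
System X = List X → Rel X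

module _ {X : Set} where

  Dom : Rel X → Pred X
  Dom R x = R x x

  Strict : Rel X → Rel X
  Strict R x y = R x y × x ≢ y

  record WellOrderOf (Y : Pred X) (R : Rel X) : Set₁ where
    field
      field-⊆   : ∀ {x y} → R x y → Y x × Y y
      refl-on   : ∀ {x} → Y x → R x x
      antisym   : ∀ {x y} → R x y → R y x → x ≡ y
      trans     : ∀ {x y z} → R x y → R y z → R x z
      total     : ∀ {x y} → Y x → Y y → R x y ⊎ R y x
      least     : (P : Pred X) → (Σ X λ x → P x × Y x) →
                  Σ X λ m → P m × Y m × (∀ z → P z → Y z → R m z)

  -- ≼ is an m-ordering system on the set Y ⊆ X (recursive definition).
  -- The case m = 0 is not defined in the paper (0 < m); we make it empty.
  OrdSysOn : ℕ → Pred X → System X → Set₁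
  OrdSysOn zero Y ≼ = Lift _ ⊥
  OrdSysOn (suc zero) Y ≼ = WellOrderOf Y (≼ [])
  OrdSysOn (suc (suc m)) Y ≼ =
    WellOrderOf Y (≼ []) ×
    (∀ x₀ → Y x₀ →
      OrdSysOn (suc m) (λ x → Strict (≼ []) x x₀) (λ t → ≼ (x₀ ∷ t)))

  Respects : System X → Set
  Respects ≼ = ∀ s s' → Unique s → Unique s' → (∀ z → (z ∈ s) ⇔ (z ∈ s')) →
               ∀ x y → ≼ s x y ⇔ ≼ s' x y

  OrderingSystem : ℕ → System X → Set₁
  OrderingSystem m ≼ = Respects ≼ × OrdSysOn m (λ _ → ⊤) ≼

  Remove : List X → X → List X → Set
  Remove s y s' = y ∈ s × y ∉ s' × Unique s' × (∀ z → (z ∈ s) ⇔ (z ≡ y ⊎ z ∈ s'))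

  IsMin : System X → List X → X → Set
  IsMin ≼ s y = Σ (List X) λ s' → Remove s y s' × Dom (≼ s') y

  Predom : Pred X → System X → List X → Pred X
  Predom Y ≼ [] x = Y x
  Predom Y ≼ s@(_ ∷ _) x =
    Σ X λ y → Σ (List X) λ s' →
      Remove s y s' × Dom (≼ s') y × Dom (≼ s') x × Strict (≼ s') x y

-- Everything rests on one fact: if t is nonempty and lies below x₀ in ≼_∅, then x₀ ∉ dom(≼_t).
-- Indeed, with c the ≼_∅-maximum of t, the relation ≼_t is the slice system ≼^c taken at
-- t ∖ {c} ⊆ X_{≺c}, and the domain of a slice at a small enough set stays inside its field
-- X_{≺c}; so x₀ ∈ dom(≼_t) would give x₀ ≺ c ≺ x₀.  Consequently Min(t ∪ {x₀}) = Min t,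
-- and removing that minimum commutes with adding x₀, which matches the two predomains
-- clause by clause.  For t = ∅ both sides are X_{≺x₀}.
module Submission where

open import Defs
open import Data.Nat using (ℕ; _≤_; _<_; zero; suc; s≤s; z≤n)
open import Data.Nat.Properties using (≤-trans; ≤-reflexive)
open import Data.Unit using (⊤; tt)
open import Data.Empty using (⊥-elim)
open import Data.Product using (_×_; _,_; proj₁; proj₂; ∃-syntax)
open import Data.Sum using (_⊎_; inj₁; inj₂; [_,_]′)
open import Data.List using (List; []; _∷_; [_]; length)
open import Data.List.Properties using (length-removeAt)
open import Data.List.Relation.Unary.All as All using (All; []; _∷_; lookup)
open import Data.List.Relation.Unary.All.Properties using (anti-mono; ¬Any⇒All¬; All¬⇒¬Any)
open import Data.List.Relation.Unary.Any using (here; there; index)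
open import Data.List.Relation.Unary.AllPairs using ([]; _∷_)
open import Data.List.Relation.Unary.Unique.Propositional using (Unique)
open import Data.List.Membership.Propositional using (_∈_; _∉_; _─_)
open import Data.List.Relation.Binary.BagAndSetEquality using (_∼[_]_; set)
open import Relation.Binary.PropositionalEquality using (_≡_; _≢_; refl; ≢-sym)
open import Relation.Nullary using (¬_)
open import Function.Base using (_∘′_)
open import Function.Bundles using (_⇔_; mk⇔; Equivalence)

open Equivalence

module _ {X : Set} where

  private variable
    x y z c : X
    s s' s₁ s₂ : List X
    Y : Pred X
    R : Rel X

  Below : Rel X → X → Pred X
  Below R c z = Strict R z c

  ∉-Below : All (Below R c) s → c ∉ s
  ∉-Below below c∈s = proj₂ (lookup below c∈s) refl

  wellOrder : ∀ {k} (≼ : System X) → OrdSysOn (suc k) Y ≼ → WellOrderOf Y (≼ [])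
  wellOrder {k = zero}  ≼ os = os
  wellOrder {k = suc k} ≼ os = proj₁ os

  -- A slice λ u → ≼ (c ∷ u) only respects set equality for u ⊆ X_{≺c} (so that c ∉ u):
  -- hence respect is relativised to a field Y.
  RespectsOn : Pred X → System X → Set
  RespectsOn Y ≼ = ∀ s s' → Unique s → Unique s' → All Y s → s ∼[ set ] s' →
                   ∀ x y → ≼ s x y ⇔ ≼ s' x y

  respects⇒respectsOn : ∀ {≼} → Respects ≼ → RespectsOn Y ≼
  respects⇒respectsOn resp s s' us us' _ s∼s' = resp s s' us us' (λ z → s∼s' {z})

  respectsOn-slice : (≼ : System X) → WellOrderOf Y (≼ []) → RespectsOn Y ≼ →
                     Y c → RespectsOn (Below (≼ []) c) (λ u → ≼ (c ∷ u))
  respectsOn-slice {c = c} ≼ wo resp Yc s s' us us' below s∼s' =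
    resp (c ∷ s) (c ∷ s') (c∉ below ∷ us) (c∉ (anti-mono (from s∼s') below) ∷ us')
         (Yc ∷ All.map (λ z≺c → proj₁ (WellOrderOf.field-⊆ wo (proj₁ z≺c))) below)
         (mk⇔ (cons-⊆ (to s∼s')) (cons-⊆ (from s∼s')))
    where
    c∉ : ∀ {u} → All (Below (≼ []) c) u → All (c ≢_) u
    c∉ = All.map (λ z≺c → ≢-sym (proj₂ z≺c))
    cons-⊆ : ∀ {u u'} → (∀ {z} → z ∈ u → z ∈ u') → ∀ {z} → z ∈ c ∷ u → z ∈ c ∷ u'
    cons-⊆ u⊆u' (here e)  = here e
    cons-⊆ u⊆u' (there q) = there (u⊆u' q)

  ∈-─⁻ : (p : y ∈ s) → z ∈ s ─ p → z ∈ s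
  ∈-─⁻ (here _)  q         = there q
  ∈-─⁻ (there p) (here e)  = here e
  ∈-─⁻ (there p) (there q) = there (∈-─⁻ p q)

  ∈-─-split : (p : y ∈ s) → z ∈ s → z ≡ y ⊎ z ∈ s ─ p
  ∈-─-split (here refl) (here e)  = inj₁ e
  ∈-─-split (here _)    (there q) = inj₂ q
  ∈-─-split (there p)   (here e)  = inj₂ (here e)
  ∈-─-split (there p)   (there q) = [ inj₁ , (λ r → inj₂ (there r)) ]′ (∈-─-split p q)

  ∉-─ : Unique s → (p : y ∈ s) → y ∉ s ─ p
  ∉-─ (a∉ ∷ _)  (here refl) q           = All¬⇒¬Any a∉ q
  ∉-─ (a∉ ∷ _)  (there p)   (here refl) = All¬⇒¬Any a∉ p
  ∉-─ (_ ∷ us)  (there p)   (there q)   = ∉-─ us p q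

  Unique-─ : Unique s → (p : y ∈ s) → Unique (s ─ p)
  Unique-─ (_ ∷ us)  (here _)  = us
  Unique-─ (a∉ ∷ us) (there p) = anti-mono (∈-─⁻ p) a∉ ∷ Unique-─ us p

  Remove-─ : Unique s → (p : y ∈ s) → Remove s y (s ─ p)
  Remove-─ us p =
    p , ∉-─ us p , Unique-─ us p ,
    λ z → mk⇔ (∈-─-split p) [ (λ { refl → p }) , ∈-─⁻ p ]′

  Remove⇒∼ : Remove s y s' → s ∼[ set ] y ∷ s'
  Remove⇒∼ (_ , _ , _ , eqv) {z} =
    mk⇔ (λ q → [ here , there ]′ (to (eqv z) q))
        (λ { (here e) → from (eqv z) (inj₁ e) ; (there q) → from (eqv z) (inj₂ q) })

  Remove⇒Unique : Remove s y s' → Unique s'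
  Remove⇒Unique (_ , _ , us' , _) = us'

  Remove⇒Unique-∷ : Remove s y s' → Unique (y ∷ s')
  Remove⇒Unique-∷ rm@(_ , y∉s' , _ , _) = ¬Any⇒All¬ _ y∉s' ∷ Remove⇒Unique rm

  Remove-cons : x ∉ s → Remove s y s' → Remove (x ∷ s) y (x ∷ s')
  Remove-cons {x = x} {s = s} {y = y} {s' = s'} x∉s (y∈s , y∉s' , us' , eqv) =
    there y∈s , y∉xs' , ¬Any⇒All¬ _ (x∉s ∘′ s'⊆s) ∷ us' , λ z → mk⇔ (split z) (join z)
    where
    s'⊆s : ∀ {z} → z ∈ s' → z ∈ s
    s'⊆s {z} q = from (eqv z) (inj₂ q)
    y∉xs' : y ∉ x ∷ s'
    y∉xs' (here refl) = x∉s y∈s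
    y∉xs' (there q)   = y∉s' q
    split : ∀ z → z ∈ x ∷ s → z ≡ y ⊎ z ∈ x ∷ s'
    split z (here e)  = inj₂ (here e)
    split z (there q) = [ inj₁ , (λ r → inj₂ (there r)) ]′ (to (eqv z) q)
    join : ∀ z → z ≡ y ⊎ z ∈ x ∷ s' → z ∈ x ∷ s
    join z (inj₁ e)         = there (from (eqv z) (inj₁ e))
    join z (inj₂ (here e))  = here e
    join z (inj₂ (there q)) = there (s'⊆s q)

  Remove-∼ : Remove s y s₁ → Remove s y s₂ → s₁ ∼[ set ] s₂
  Remove-∼ rm₁ rm₂ = mk⇔ (⊆-of rm₁ rm₂) (⊆-of rm₂ rm₁)
    where
    ⊆-of : Remove s y s₁ → Remove s y s₂ → z ∈ s₁ → z ∈ s₂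
    ⊆-of {z = z} (_ , y∉s₁ , _ , eqv₁) (_ , _ , _ , eqv₂) q
      with to (eqv₂ z) (from (eqv₁ z) (inj₂ q))
    ... | inj₁ refl = ⊥-elim (y∉s₁ q)
    ... | inj₂ r    = r

  maximum : WellOrderOf Y R → All Y (x ∷ s) → ∃[ c ] c ∈ x ∷ s × All (λ z → R z c) (x ∷ s)
  maximum wo (Yx ∷ []) = _ , here refl , WellOrderOf.refl-on wo Yx ∷ []
  maximum wo (Yx ∷ Ys@(_ ∷ _)) with maximum wo Ys
  ... | c , c∈s , max with WellOrderOf.total wo Yx (lookup Ys c∈s)
  ... | inj₁ x≼c = c , there c∈s , x≼c ∷ max
  ... | inj₂ c≼x =
    _ , here refl , WellOrderOf.refl-on wo Yx ∷ All.map (λ z≼c → WellOrderOf.trans wo z≼c c≼x) max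

  Remove-max⇒Below : Remove s c s' → All (λ z → R z c) s → All (Below R c) s'
  Remove-max⇒Below (_ , c∉s' , _ , eqv) max =
    All.tabulate (λ {z} q → lookup max (from (eqv z) (inj₂ q)) , λ { refl → c∉s' q })

  mutual
    dom⊆field : ∀ k (≼ : System X) → OrdSysOn (suc k) Y ≼ → RespectsOn Y ≼ →
                Unique s → All Y s → length s ≤ k → Dom (≼ s) x → Y x
    dom⊆field {s = []} k ≼ os resp _ _ _ x∈ =
      proj₁ (WellOrderOf.field-⊆ (wellOrder ≼ os) x∈)
    dom⊆field {s = _ ∷ _} zero ≼ os resp _ _ () _
    dom⊆field {s = _ ∷ _} (suc k) ≼ os resp us Ys len x∈
      with dom⇒below-member k ≼ os resp us Ys len x∈
    ... | _ , _ , x≼c , _ = proj₁ (WellOrderOf.field-⊆ (wellOrder ≼ os) x≼c)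

    dom⇒below-member : ∀ k (≼ : System X) → OrdSysOn (suc (suc k)) Y ≼ → RespectsOn Y ≼ →
                       Unique (y ∷ s) → All Y (y ∷ s) → length (y ∷ s) ≤ suc k →
                       Dom (≼ (y ∷ s)) x → ∃[ c ] c ∈ y ∷ s × Strict (≼ []) x c
    dom⇒below-member {Y = Y} {y = y} {s = s} {x = x} k ≼ (wo , slices) resp us Ys (s≤s len) x∈
      with maximum wo Ys
    ... | c , c∈ys , max =
      c , c∈ys ,
      dom⊆field k (λ u → ≼ (c ∷ u)) (slices c Yc) (respectsOn-slice ≼ wo resp Yc)
        (Remove⇒Unique rm) (Remove-max⇒Below {R = ≼ []} rm max) len' x∈c∷u
      where
      Yc : Y c
      Yc = lookup Ys c∈ys
      rm : Remove (y ∷ s) c ((y ∷ s) ─ c∈ys)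
      rm = Remove-─ us c∈ys
      len' : length ((y ∷ s) ─ c∈ys) ≤ k
      len' = ≤-trans (≤-reflexive (length-removeAt (y ∷ s) (index c∈ys))) len
      x∈c∷u : Dom (≼ (c ∷ ((y ∷ s) ─ c∈ys))) x
      x∈c∷u = to (resp _ _ us (Remove⇒Unique-∷ rm) Ys (Remove⇒∼ rm) x x) x∈

  strictUpperBound∉dom : ∀ k (≼ : System X) → OrdSysOn (suc (suc k)) Y ≼ → RespectsOn Y ≼ →
                         Unique (y ∷ s) → All (Below (≼ []) x) (y ∷ s) → length (y ∷ s) ≤ suc k →
                         ¬ Dom (≼ (y ∷ s)) x
  strictUpperBound∉dom {Y = Y} {y = y} {s = s} {x = x} k ≼ os resp us below len x∈ =
    let c , c∈ys , x≼c , x≢c = dom⇒below-member k ≼ os resp us Ys len x∈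
    in  x≢c (WellOrderOf.antisym wo x≼c (proj₁ (lookup below c∈ys)))
    where
    wo : WellOrderOf Y (≼ [])
    wo = wellOrder ≼ os
    Ys : All Y (y ∷ s)
    Ys = All.map (λ z≺x → proj₁ (WellOrderOf.field-⊆ wo (proj₁ z≺x))) below

  Precedes : System X → List X → X → X → Set
  Precedes ≼ s x y = Dom (≼ s) y × Dom (≼ s) x × Strict (≼ s) x y

  Precedes-resp : (≼ : System X) → Respects ≼ → Unique s₁ → Unique s₂ → s₁ ∼[ set ] s₂ →
                  Precedes ≼ s₁ x y → Precedes ≼ s₂ x y
  Precedes-resp {s₁ = s₁} {s₂ = s₂} {x = x} {y = y} ≼ resp u₁ u₂ s₁∼s₂ (y∈ , x∈ , x≼y , x≢y) =
    transport y y y∈ , transport x x x∈ , transport x y x≼y , x≢y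
    where
    transport : ∀ a b → ≼ s₁ a b → ≼ s₂ a b
    transport a b = to (resp s₁ s₂ u₁ u₂ (λ z → s₁∼s₂ {z}) a b)

  predom-slice-[] : (≼ : System X) → Respects ≼ → WellOrderOf (λ _ → ⊤) (≼ []) →
                    Below (≼ []) c x ⇔ Predom (λ _ → ⊤) ≼ [ c ] x
  predom-slice-[] {c = c} {x = x} ≼ resp wo = mk⇔ forward backward
    where
    rm : Remove [ c ] c []
    rm = Remove-─ ([] ∷ []) (here refl)
    forward : Below (≼ []) c x → Predom (λ _ → ⊤) ≼ [ c ] x
    forward x≺c = c , [] , rm , WellOrderOf.refl-on wo tt , WellOrderOf.refl-on wo tt , x≺c
    backward : Predom (λ _ → ⊤) ≼ [ c ] x → Below (≼ []) c x
    backward (_ , s' , rm'@(here refl , _) , prec) =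
      proj₂ (proj₂ (Precedes-resp ≼ resp (Remove⇒Unique rm') [] (Remove-∼ rm' rm) prec))

  predom-slice-∷ : ∀ k (≼ : System X) → Respects ≼ → OrdSysOn (suc (suc k)) (λ _ → ⊤) ≼ →
                   Unique (y ∷ s) → All (Below (≼ []) c) (y ∷ s) → length (y ∷ s) ≤ suc k →
                   Predom (Below (≼ []) c) (λ u → ≼ (c ∷ u)) (y ∷ s) x ⇔
                   Predom (λ _ → ⊤) ≼ (c ∷ y ∷ s) x
  predom-slice-∷ {y = y} {s = s} {c = c} {x = x} k ≼ resp os ut below len =
    mk⇔ forward backward
    where
    c∉t : c ∉ y ∷ s
    c∉t = ∉-Below {R = ≼ []} below
    forward : Predom (Below (≼ []) c) (λ u → ≼ (c ∷ u)) (y ∷ s) x →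
              Predom (λ _ → ⊤) ≼ (c ∷ y ∷ s) x
    forward (z , s' , rm , prec) = z , c ∷ s' , Remove-cons c∉t rm , prec
    backward : Predom (λ _ → ⊤) ≼ (c ∷ y ∷ s) x →
               Predom (Below (≼ []) c) (λ u → ≼ (c ∷ u)) (y ∷ s) x
    backward (_ , s'' , rm@(here refl , _) , prec) =
      ⊥-elim (strictUpperBound∉dom k ≼ os (respects⇒respectsOn resp) ut below len
        (proj₁ (Precedes-resp ≼ resp (Remove⇒Unique rm) ut
                  (Remove-∼ rm (Remove-─ (¬Any⇒All¬ _ c∉t ∷ ut) (here refl))) prec)))
    backward (z , s'' , rm@(there p , _) , prec) =
      z , (y ∷ s) ─ p , rm' ,
      Precedes-resp ≼ resp (Remove⇒Unique rm) (Remove⇒Unique rmc) (Remove-∼ rm rmc) prec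
      where
      rm' : Remove (y ∷ s) z ((y ∷ s) ─ p)
      rm' = Remove-─ ut p
      rmc : Remove (c ∷ y ∷ s) z (c ∷ ((y ∷ s) ─ p))
      rmc = Remove-cons c∉t rm'

lemma5p4 : {X : Set} (n : ℕ) → 2 ≤ n → (≼ : System X) → OrderingSystem n ≼ →
           (x₀ : X) (t : List X) → Unique t → length t < n → All (Dom (≼ [ x₀ ])) t →
           ∀ x → Predom (λ z → Strict (≼ []) z x₀) (λ u → ≼ (x₀ ∷ u)) t x
                 ⇔ Predom (λ _ → ⊤) ≼ (x₀ ∷ t) x
lemma5p4 (suc (suc m)) (s≤s (s≤s z≤n)) ≼ (resp , wo , _) x₀ [] _ _ _ x = predom-slice-[] ≼ resp wo
lemma5p4 (suc (suc m)) (s≤s (s≤s z≤n)) ≼ (resp , os@(_ , slices)) x₀ t@(_ ∷ _) ut (s≤s len) domt x =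
  predom-slice-∷ m ≼ resp os ut t≺x₀ len
  where
  wo₀ : WellOrderOf (Below (≼ []) x₀) (≼ [ x₀ ])
  wo₀ = wellOrder (λ u → ≼ (x₀ ∷ u)) (slices x₀ tt)
  t≺x₀ : All (Below (≼ []) x₀) t
  t≺x₀ = All.map (λ z∈ → proj₁ (WellOrderOf.field-⊆ wo₀ z∈)) domt
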